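{- Let $n\in\mathbb{N}$ be odd with $n\geq 105$, and let $G=C_n(\{1,5,n-5,n-1\})$. Then $\lambda_{(3,2,1)}(G)\leq 14$.
   Context: For $n\ge 3$ and $S\subseteq\{1,\dots,n-1\}$ closed under $x\mapsto n-x$, the circulant $C_n(S)$ is the graph with vertex set $\{u_1,\dots,u_n\}$ in which $u_iu_j$ is an edge iff $|i-j|\in S$. An $L(3,2,1)$-labeling of a graph $G$ is a function $f:V(G)\to\mathbb{N}\cup\{0\}$ such that $|f(x)-f(y)|>3-\operatorname{dist}_G(x,y)$ for all distinct $x,y\in V(G)$. $\lambda_{(3,2,1)}(G)$ is the minimum, over all $L(3,2,1)$-labelings of $G$, of the difference between the largest and smallest label used. -}

module Defs where

open import Data.Nat using (ℕ; zero; suc; _+_; _<_; _≤_; ∣_-_∣)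
open import Data.Fin using (Fin; toℕ)
open import Data.Product using (Σ; ∃; _×_)
open import Data.Sum using (_⊎_)
open import Relation.Binary.PropositionalEquality using (_≡_)
open import Relation.Nullary using (¬_)

-- Circulant graph C_n(S): vertices u_1..u_n are represented by Fin n
-- (u_{i+1} ↦ i); u_i u_j is an edge iff |i - j| ∈ S.
CircAdj : (n : ℕ) → (S : ℕ → Set) → Fin n → Fin n → Set
CircAdj n S x y = S ∣ toℕ x - toℕ y ∣

S-1-5 : ℕ → ℕ → Set
S-1-5 n d = (d ≡ 1) ⊎ (d ≡ 5) ⊎ (d + 5 ≡ n) ⊎ (d + 1 ≡ n)

data Walk {V : Set} (Adj : V → V → Set) : V → V → ℕ → Set where
  here : ∀ {x} → Walk Adj x x zero
  step : ∀ {x y z k} → Adj x y → Walk Adj y z k → Walk Adj x z (suc k)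

-- dist_G(x,y) = d : there is a walk of length d and none shorter.
-- (If x,y are disconnected, no d satisfies this; dist = ∞.)
Dist : {V : Set} → (V → V → Set) → V → V → ℕ → Set
Dist Adj x y d = Walk Adj x y d × (∀ k → k < d → ¬ Walk Adj x y k)

-- L(3,2,1)-labeling: |f x - f y| > 3 - dist(x,y) for distinct x, y.
-- With d = dist(x,y) ∈ ℕ this reads 3 < |f x - f y| + d; if dist = ∞
-- the condition is vacuous.
IsL321Labeling : {V : Set} → (V → V → Set) → (V → ℕ) → Set
IsL321Labeling Adj f =
  ∀ x y → ¬ (x ≡ y) → ∀ d → Dist Adj x y d → 3 < ∣ f x - f y ∣ + d

L321SpanAtMost : {V : Set} → (V → V → Set) → ℕ → Set
L321SpanAtMost {V} Adj m =
  Σ (V → ℕ) λ f → IsL321Labeling Adj f ×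
    (∃ λ lo → ∀ x → lo ≤ f x × f x ≤ lo + m)

{-# OPTIONS --safe #-}
module Submission where

-- Label u_i by W[i] for a cyclic word W of length n over {0, ..., 14}. A walk of length
-- k ≤ 3 in C_n({1, 5, n-5, n-1}) is a sequence of ±1, ±5 steps, so its ends lie at cyclic
-- offset e ≤ 15, and enumerating the 85 step sequences of length at most 3 shows that the
-- L(3,2,1) condition only asks for |W[i] - W[i + e]| ≥ need e: a check of the windows of
-- length 16 of W. For odd n = 105 + 2r + 12q with r < 6 take W = C_r B^q, with six explicit
-- prefixes C_r and a block B of period 12; every window of C_r B^q already occurs in C_r B^q'
-- for some q' ≤ 3, so finitely many checked words cover all n.

open import Defs
open import Data.Bool using (Bool; true; _∧_; _∨_; T)
open import Data.Bool.ListAction using (all)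
open import Data.Bool.Properties using (T-∧; ∧-assoc)
open import Data.Empty using (⊥-elim)
open import Data.Fin using (Fin; toℕ)
open import Data.Fin.Patterns using (0F; 1F; 2F; 3F; 4F; 5F)
open import Data.Fin.Properties using (toℕ<n; toℕ-injective)
open import Data.List using (List; []; _∷_; _++_; take; length; map; upTo)
open import Data.List.Membership.Propositional using (_∈_)
open import Data.List.Properties using (length-take; length-++; take-take; ++-assoc; ++-identityʳ)
open import Data.List.Relation.Unary.All as All using (All)
open import Data.List.Relation.Unary.All.Properties using (all⁺; ++⁺)
open import Data.List.Relation.Unary.Any using (here; there)
open import Data.Nat using (ℕ; zero; suc; pred; _+_; _*_; _∸_; _⊓_; _≤_; _<_; _%_; _≡ᵇ_; _≤ᵇ_; ∣_-_∣; NonZero; z≤n; s≤s; _<?_; _≤?_)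
open import Data.Nat.DivMod using (_/_; _divMod_; module DivMod; m≡m%n+[m/n]*n; %-distribˡ-+; [m+kn]%n≡m%n; [m+n]%n≡m%n; m<n⇒m%n≡m)
open import Data.Nat.ListAction using (sum)
open import Data.Nat.Properties
open import Data.Nat.Tactic.RingSolver using (solve-∀)
open import Data.Product using (Σ; ∃; ∃₂; _×_; _,_; proj₁; proj₂)
open import Data.Sum using (_⊎_; inj₁; inj₂)
open import Data.Unit using (tt)
open import Function using (_∘_)
open import Function.Bundles using (Equivalence)
open import Relation.Nullary using (¬_; yes; no)
open import Relation.Binary.PropositionalEquality
open import Algebra.Properties.CommutativeSemigroup +-commutativeSemigroup using (xy∙z≈xz∙y)

∣m-n∣+m≡n : ∀ {m n} → m ≤ n → ∣ m - n ∣ + m ≡ n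
∣m-n∣+m≡n {m} m≤n = trans (cong (_+ m) (m≤n⇒∣m-n∣≡n∸m m≤n)) (m∸n+n≡m m≤n)

∣m-n∣+n≡m : ∀ {m n} → n ≤ m → ∣ m - n ∣ + n ≡ m
∣m-n∣+n≡m {m} {n} n≤m = trans (cong (_+ n) (∣-∣-comm m n)) (∣m-n∣+m≡n n≤m)

module ModularArithmetic (n : ℕ) .{{_ : NonZero n}} where

  infix 4 _≈_
  _≈_ : ℕ → ℕ → Set
  a ≈ b = a % n ≡ b % n

  +-congʳ-≈ : ∀ {a b} c → a ≈ b → a + c ≈ b + c
  +-congʳ-≈ {a} {b} c a≈b = begin
    (a + c) % n          ≡⟨ %-distribˡ-+ a c n ⟩
    (a % n + c % n) % n  ≡⟨ cong (λ z → (z + c % n) % n) a≈b ⟩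
    (b % n + c % n) % n  ≡⟨ %-distribˡ-+ b c n ⟨
    (b + c) % n          ∎
    where open ≡-Reasoning

  -- Adding c * pred n turns + c into + c * n.
  +-cancelʳ-≈ : ∀ {a b} c → a + c ≈ b + c → a ≈ b
  +-cancelʳ-≈ {a} {b} c a+c≈b+c = begin
    a % n                    ≡⟨ [m+kn]%n≡m%n a c n ⟨
    (a + c * n) % n          ≡⟨ cong (_% n) (complete a) ⟩
    (a + c + c * pred n) % n ≡⟨ +-congʳ-≈ (c * pred n) a+c≈b+c ⟩
    (b + c + c * pred n) % n ≡⟨ cong (_% n) (complete b) ⟨
    (b + c * n) % n          ≡⟨ [m+kn]%n≡m%n b c n ⟩
    b % n                    ∎
    where
    open ≡-Reasoning
    complete : ∀ x → x + c * n ≡ x + c + c * pred n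
    complete x = begin
      x + c * n              ≡⟨ cong (λ m → x + c * m) (suc-pred n) ⟨
      x + c * suc (pred n)   ≡⟨ cong (x +_) (*-suc c (pred n)) ⟩
      x + (c + c * pred n)   ≡⟨ +-assoc x c (c * pred n) ⟨
      x + c + c * pred n     ∎

  ≈⇒≡ : ∀ {a b} → a < n → b < n → a ≈ b → a ≡ b
  ≈⇒≡ a<n b<n a≈b = trans (sym (m<n⇒m%n≡m a<n)) (trans a≈b (m<n⇒m%n≡m b<n))

  displacement-trans : ∀ {a b c p q p′ q′} →
    a + p ≈ b + q → b + p′ ≈ c + q′ → a + (p + p′) ≈ c + (q + q′)
  displacement-trans {a} {b} {c} {p} {q} {p′} {q′} ab bc = begin
    (a + (p + p′)) % n  ≡⟨ cong (_% n) (+-assoc a p p′) ⟨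
    (a + p + p′) % n    ≡⟨ +-congʳ-≈ p′ ab ⟩
    (b + q + p′) % n    ≡⟨ cong (_% n) (xy∙z≈xz∙y b q p′) ⟩
    (b + p′ + q) % n    ≡⟨ +-congʳ-≈ q bc ⟩
    (c + q′ + q) % n    ≡⟨ cong (_% n) (trans (+-assoc c q′ q) (cong (c +_) (+-comm q′ q))) ⟩
    (c + (q + q′)) % n  ∎
    where open ≡-Reasoning

  displacement-offset : ∀ {a b p q} → a + p ≈ b + q →
    a ≈ b + ∣ p - q ∣ ⊎ b ≈ a + ∣ p - q ∣
  displacement-offset {a} {b} {p} {q} a+p≈b+q with ≤-total p q
  ... | inj₁ p≤q = inj₁ (+-cancelʳ-≈ p (begin
    (a + p) % n                ≡⟨ a+p≈b+q ⟩
    (b + q) % n                ≡⟨ cong (λ m → (b + m) % n) (∣m-n∣+m≡n p≤q) ⟨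
    (b + (∣ p - q ∣ + p)) % n  ≡⟨ cong (_% n) (+-assoc b _ p) ⟨
    (b + ∣ p - q ∣ + p) % n    ∎))
    where open ≡-Reasoning
  ... | inj₂ q≤p = inj₂ (+-cancelʳ-≈ q (begin
    (b + q) % n                ≡⟨ a+p≈b+q ⟨
    (a + p) % n                ≡⟨ cong (λ m → (a + m) % n) (∣m-n∣+n≡m q≤p) ⟨
    (a + (∣ p - q ∣ + q)) % n  ≡⟨ cong (_% n) (+-assoc a _ q) ⟨
    (a + ∣ p - q ∣ + q) % n    ∎))
    where open ≡-Reasoning

data Step : Set where
  +1 −1 +5 −5 : Step

fwd bwd : Step → ℕ
fwd +1 = 1
fwd +5 = 5
fwd _  = 0
bwd −1 = 1
bwd −5 = 5
bwd _  = 0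

opposite : Step → Step
opposite +1 = −1
opposite −1 = +1
opposite +5 = −5
opposite −5 = +5

forward backward : List Step → ℕ
forward l = sum (map fwd l)
backward l = sum (map bwd l)

module CirculantWalks (n : ℕ) .{{_ : NonZero n}} where

  open ModularArithmetic n

  unwrapped-step : ∀ {a b d} → b ≡ a + d → a + d ≈ b + 0
  unwrapped-step {b = b} b≡a+d = cong (_% n) (trans (sym b≡a+d) (sym (+-identityʳ b)))

  wrapped-step : ∀ {a b d s} → b ≡ a + d → d + s ≡ n → a + 0 ≈ b + s
  wrapped-step {a} {b} {d} {s} b≡a+d d+s≡n = begin
    (a + 0) % n        ≡⟨ cong (_% n) (+-identityʳ a) ⟩
    a % n              ≡⟨ [m+n]%n≡m%n a n ⟨
    (a + n) % n        ≡⟨ cong (λ m → (a + m) % n) d+s≡n ⟨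
    (a + (d + s)) % n  ≡⟨ cong (_% n) (trans (sym (+-assoc a d s)) (cong (_+ s) (sym b≡a+d))) ⟩
    (b + s) % n        ∎
    where open ≡-Reasoning

  step-of-difference : ∀ {a b d} → b ≡ a + d → S-1-5 n d → ∃ λ s → a + fwd s ≈ b + bwd s
  step-of-difference {a} b≡a+d (inj₁ refl)                = +1 , unwrapped-step {a} b≡a+d
  step-of-difference {a} b≡a+d (inj₂ (inj₁ refl))         = +5 , unwrapped-step {a} b≡a+d
  step-of-difference {a} b≡a+d (inj₂ (inj₂ (inj₁ d+5≡n))) = −5 , wrapped-step {a} b≡a+d d+5≡n
  step-of-difference {a} b≡a+d (inj₂ (inj₂ (inj₂ d+1≡n))) = −1 , wrapped-step {a} b≡a+d d+1≡n

  opposite-step : ∀ {a b} s → a + fwd s ≈ b + bwd s → b + fwd (opposite s) ≈ a + bwd (opposite s)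
  opposite-step +1 = sym
  opposite-step −1 = sym
  opposite-step +5 = sym
  opposite-step −5 = sym

  adjacent⇒step : ∀ {x y} → CircAdj n (S-1-5 n) x y → ∃ λ s → toℕ x + fwd s ≈ toℕ y + bwd s
  adjacent⇒step {x} {y} adj with ≤-total (toℕ x) (toℕ y)
  ... | inj₁ x≤y = step-of-difference {toℕ x} (sym (m+[n∸m]≡n x≤y))
                      (subst (S-1-5 n) (m≤n⇒∣m-n∣≡n∸m x≤y) adj)
  ... | inj₂ y≤x with step-of-difference {toℕ y} (sym (m+[n∸m]≡n y≤x))
                      (subst (S-1-5 n) (m≤n⇒∣n-m∣≡n∸m y≤x) adj)
  ...   | s , y→x = opposite s , opposite-step s y→x

  walk⇒steps : ∀ {x y k} → Walk (CircAdj n (S-1-5 n)) x y k →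
    Σ (List Step) λ l → length l ≡ k × toℕ x + forward l ≈ toℕ y + backward l
  walk⇒steps here = [] , refl , refl
  walk⇒steps {x} {z} (step {y = y} adj walk) with adjacent⇒step {x} {y} adj | walk⇒steps walk
  ... | s , x→y | l , refl , y→z =
    s ∷ l , refl , displacement-trans {toℕ x} {toℕ y} {toℕ z} x→y y→z

-- need e: the least |f(u) - f(v)| the L(3,2,1) condition can demand of vertices e apart
-- along the cycle, i.e. 4 minus the fewest ±1, ±5 steps adding up to ±e (0 if more than 3).
need : ℕ → ℕ
need 1  = 3
need 5  = 3
need 2  = 2
need 4  = 2
need 6  = 2
need 10 = 2
need 3  = 1
need 7  = 1
need 9  = 1
need 11 = 1
need 15 = 1
need _  = 0

compatible : ℕ → ℕ → Bool
compatible e k = (e ≡ᵇ 0) ∨ ((e ≤ᵇ 15) ∧ (4 ≤ᵇ need e + k))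

admissible : List Step → Bool
admissible l = compatible ∣ forward l - backward l ∣ (length l)

steps : List Step
steps = +1 ∷ −1 ∷ +5 ∷ −5 ∷ []

∈-steps : ∀ s → s ∈ steps
∈-steps +1 = here refl
∈-steps −1 = there (here refl)
∈-steps +5 = there (there (here refl))
∈-steps −5 = there (there (there (here refl)))

everySequence : ℕ → (List Step → Bool) → Bool
everySequence zero    p = p []
everySequence (suc k) p = all (λ s → everySequence k (p ∘ (s ∷_))) steps

everySequence-sound : ∀ p l → T (everySequence (length l) p) → T (p l)
everySequence-sound p []      t = t
everySequence-sound p (s ∷ l) t = everySequence-sound (p ∘ (s ∷_)) l (All.lookup t′ (∈-steps s))
  where
  t′ : All (λ s′ → T (everySequence (length l) (p ∘ (s′ ∷_)))) steps
  t′ = all⁺ (λ s′ → everySequence (length l) (p ∘ (s′ ∷_))) steps t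

short-sequences-admissible : ∀ l → length l ≤ 3 → T (admissible l)
short-sequences-admissible l |l|≤3 = everySequence-sound admissible l (check (length l) |l|≤3)
  where
  check : ∀ k → k ≤ 3 → T (everySequence k admissible)
  check 0 _ = tt
  check 1 _ = tt
  check 2 _ = tt
  check 3 _ = tt
  check (suc (suc (suc (suc _)))) (s≤s (s≤s (s≤s ())))

infixl 9 _!_
_!_ : List ℕ → ℕ → ℕ
[]       ! _     = 0
(x ∷ xs) ! zero  = x
(x ∷ xs) ! suc i = xs ! i

!-++ˡ : ∀ xs {ys i} → i < length xs → (xs ++ ys) ! i ≡ xs ! i
!-++ˡ (x ∷ xs) {i = zero}  _         = refl
!-++ˡ (x ∷ xs) {i = suc i} (s≤s i<n) = !-++ˡ xs i<n

!-++ʳ : ∀ xs {ys} i → (xs ++ ys) ! (length xs + i) ≡ ys ! i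
!-++ʳ []       i = refl
!-++ʳ (x ∷ xs) i = !-++ʳ xs i

!-take : ∀ {k} xs {i} → i < k → take k xs ! i ≡ xs ! i
!-take {suc k} []       _                 = refl
!-take {suc k} (x ∷ xs) {zero}  _         = refl
!-take {suc k} (x ∷ xs) {suc i} (s≤s i<k) = !-take xs i<k

!-++-self : ∀ {n} .{{_ : NonZero n}} W {i} → length W ≡ n → i < n + n → (W ++ W) ! i ≡ W ! (i % n)
!-++-self W {i} refl i<2n with i <? length W
... | yes i<n = trans (!-++ˡ W i<n) (cong (W !_) (sym (m<n⇒m%n≡m i<n)))
... | no i≮n = begin
  (W ++ W) ! i             ≡⟨ cong ((W ++ W) !_) i≡n+r ⟨
  (W ++ W) ! (n + r)       ≡⟨ !-++ʳ W r ⟩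
  W ! r                    ≡⟨ cong (W !_) (m<n⇒m%n≡m r<n) ⟨
  W ! (r % n)              ≡⟨ cong (W !_) ([m+n]%n≡m%n r n) ⟨
  W ! ((r + n) % n)        ≡⟨ cong (λ m → W ! (m % n)) (trans (+-comm r n) i≡n+r) ⟩
  W ! (i % n)              ∎
  where
  open ≡-Reasoning
  n r : ℕ
  n = length W
  r = i ∸ n
  i≡n+r : n + r ≡ i
  i≡n+r = m+[n∸m]≡n (≮⇒≥ i≮n)
  r<n : r < n
  r<n = +-cancelˡ-< n r n (subst (_< n + n) (sym i≡n+r) i<2n)

module _ {A : Set} where

  take-++ : ∀ k (xs ys : List A) → take k (xs ++ ys) ≡ take k xs ++ take (k ∸ length xs) ys
  take-++ zero    []       ys = refl
  take-++ zero    (x ∷ xs) ys = refl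
  take-++ (suc k) []       ys = refl
  take-++ (suc k) (x ∷ xs) ys = cong (x ∷_) (take-++ k xs ys)

  take-++-take : ∀ k (xs ys : List A) → take k (xs ++ ys) ≡ take k (xs ++ take k ys)
  take-++-take k xs ys = begin
    take k (xs ++ ys)                ≡⟨ take-++ k xs ys ⟩
    take k xs ++ take d ys           ≡⟨ cong (λ m → take k xs ++ take m ys) (m≤n⇒m⊓n≡m (m∸n≤m k (length xs))) ⟨
    take k xs ++ take (d ⊓ k) ys     ≡⟨ cong (take k xs ++_) (take-take d k ys) ⟨
    take k xs ++ take d (take k ys)  ≡⟨ take-++ k xs (take k ys) ⟨
    take k (xs ++ take k ys)         ∎
    where
    open ≡-Reasoning
    d : ℕ
    d = k ∸ length xs

  take-++-≤ : ∀ {k} (xs ys : List A) → k ≤ length xs → take k (xs ++ ys) ≡ take k xs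
  take-++-≤ {k} xs ys k≤n = begin
    take k (xs ++ ys)                     ≡⟨ take-++ k xs ys ⟩
    take k xs ++ take (k ∸ length xs) ys  ≡⟨ cong (λ m → take k xs ++ take m ys) (m≤n⇒m∸n≡0 k≤n) ⟩
    take k xs ++ []                       ≡⟨ ++-identityʳ (take k xs) ⟩
    take k xs                             ∎
    where open ≡-Reasoning

  infixr 8 _^_
  _^_ : List A → ℕ → List A
  xs ^ zero  = []
  xs ^ suc q = xs ++ xs ^ q

  length-^ : ∀ xs q → length (xs ^ q) ≡ q * length xs
  length-^ xs zero    = refl
  length-^ xs (suc q) = trans (length-++ xs) (cong (length xs +_) (length-^ xs q))

  ^-2+ : ∀ xs q ys → xs ^ (2 + q) ++ ys ≡ (xs ++ xs) ++ (xs ^ q ++ ys)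
  ^-2+ xs q ys = begin
    (xs ++ xs ++ xs ^ q) ++ ys    ≡⟨ ++-assoc xs (xs ++ xs ^ q) ys ⟩
    xs ++ (xs ++ xs ^ q) ++ ys   ≡⟨ cong (xs ++_) (++-assoc xs (xs ^ q) ys) ⟩
    xs ++ xs ++ xs ^ q ++ ys     ≡⟨ ++-assoc xs xs (xs ^ q ++ ys) ⟨
    (xs ++ xs) ++ xs ^ q ++ ys   ∎
    where open ≡-Reasoning

T-∧⁻ : ∀ {x y} → T (x ∧ y) → T x × T y
T-∧⁻ = Equivalence.to T-∧

T-∧⁺ : ∀ {x y} → T x → T y → T (x ∧ y)
T-∧⁺ tx ty = Equivalence.from T-∧ (tx , ty)

module Windows (w : ℕ) (ok : ℕ → ℕ → ℕ → Bool) where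

  okFrom : ℕ → ℕ → List ℕ → Bool
  okFrom c e []       = true
  okFrom c e (d ∷ ds) = ok e c d ∧ okFrom c (suc e) ds

  windowsOK : List ℕ → List ℕ → Bool
  windowsOK []       ys = true
  windowsOK (c ∷ xs) ys = okFrom c 1 (take w (xs ++ ys)) ∧ windowsOK xs ys

  cyclicOK : List ℕ → Bool
  cyclicOK W = windowsOK W W

  okFrom-sound : ∀ c e ds {j} → T (okFrom c e ds) → j < length ds → T (ok (e + j) c (ds ! j))
  okFrom-sound c e (d ∷ ds) {zero}  t _ rewrite +-identityʳ e = proj₁ (T-∧⁻ t)
  okFrom-sound c e (d ∷ ds) {suc j} t (s≤s j<n) rewrite +-suc e j =
    okFrom-sound c (suc e) ds (proj₂ (T-∧⁻ t)) j<n

  windowsOK-sound : ∀ xs ys {i e} → T (windowsOK xs ys) → i < length xs → e < w →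
    i + suc e < length (xs ++ ys) → T (ok (suc e) (xs ! i) ((xs ++ ys) ! (i + suc e)))
  windowsOK-sound (c ∷ xs) ys {zero} {e} t _ e<w (s≤s e<n) =
    subst (λ d → T (ok (suc e) c d)) (!-take (xs ++ ys) e<w)
      (okFrom-sound c 1 (take w (xs ++ ys)) (proj₁ (T-∧⁻ t))
        (subst (e <_) (sym (length-take w (xs ++ ys))) (⊓-glb e<w e<n)))
  windowsOK-sound (c ∷ xs) ys {suc i} t (s≤s i<n) e<w (s≤s i+e<n) =
    windowsOK-sound xs ys (proj₂ (T-∧⁻ t)) i<n e<w i+e<n

  cyclicOK-sound : ∀ {n} .{{_ : NonZero n}} W {a e} → length W ≡ n → T (cyclicOK W) → w ≤ n →
    a < n → e < w → T (ok (suc e) (W ! a) (W ! ((a + suc e) % n)))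
  cyclicOK-sound W {a} {e} refl t w≤n a<n e<w =
    subst (λ d → T (ok (suc e) (W ! a) d)) (!-++-self W refl a+e<2n)
      (windowsOK-sound W W t a<n e<w (subst (a + suc e <_) (sym (length-++ W)) a+e<2n))
    where
    a+e<2n : a + suc e < length W + length W
    a+e<2n = +-mono-<-≤ a<n (≤-trans e<w w≤n)

  windowsOK-take : ∀ xs ys → windowsOK xs ys ≡ windowsOK xs (take w ys)
  windowsOK-take []       ys = refl
  windowsOK-take (c ∷ xs) ys =
    cong₂ (λ d b → okFrom c 1 d ∧ b) (take-++-take w xs ys) (windowsOK-take xs ys)

  windowsOK-prefix : ∀ xs ys zs → w ≤ length ys → windowsOK xs (ys ++ zs) ≡ windowsOK xs ys
  windowsOK-prefix xs ys zs w≤n = begin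
    windowsOK xs (ys ++ zs)           ≡⟨ windowsOK-take xs (ys ++ zs) ⟩
    windowsOK xs (take w (ys ++ zs))  ≡⟨ cong (windowsOK xs) (take-++-≤ ys zs w≤n) ⟩
    windowsOK xs (take w ys)          ≡⟨ windowsOK-take xs ys ⟨
    windowsOK xs ys                   ∎
    where open ≡-Reasoning

  windowsOK-++ : ∀ xs ys zs → windowsOK (xs ++ ys) zs ≡ windowsOK xs (ys ++ zs) ∧ windowsOK ys zs
  windowsOK-++ []       ys zs = refl
  windowsOK-++ (c ∷ xs) ys zs = begin
    okFrom c 1 (take w ((xs ++ ys) ++ zs)) ∧ windowsOK (xs ++ ys) zs
      ≡⟨ cong₂ (λ d b → okFrom c 1 (take w d) ∧ b) (++-assoc xs ys zs) (windowsOK-++ xs ys zs) ⟩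
    okFrom c 1 (take w (xs ++ ys ++ zs)) ∧ (windowsOK xs (ys ++ zs) ∧ windowsOK ys zs)
      ≡⟨ ∧-assoc (okFrom c 1 (take w (xs ++ ys ++ zs))) _ _ ⟨
    (okFrom c 1 (take w (xs ++ ys ++ zs)) ∧ windowsOK xs (ys ++ zs)) ∧ windowsOK ys zs
      ∎
    where open ≡-Reasoning

  cyclicOK-++ : ∀ C X → w ≤ length C →
    cyclicOK (C ++ X) ≡ windowsOK C (X ++ C ++ X) ∧ windowsOK X C
  cyclicOK-++ C X w≤|C| =
    trans (windowsOK-++ C X (C ++ X)) (cong (windowsOK C (X ++ C ++ X) ∧_) (windowsOK-prefix X C X w≤|C|))

  windowsOK-before-^ : ∀ xs A q zs → w ≤ length (A ++ A) →
    windowsOK xs (A ^ (2 + q) ++ zs) ≡ windowsOK xs (A ++ A)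
  windowsOK-before-^ xs A q zs w≤|AA| =
    trans (cong (windowsOK xs) (^-2+ A q zs)) (windowsOK-prefix xs (A ++ A) (A ^ q ++ zs) w≤|AA|)

  -- As w ≤ 2 |A|, each window of C A^q with q ≥ 2 is a window of C A^2 or of C A^3.
  cyclicOK-pump : ∀ C A → w ≤ length C → w ≤ length (A ++ A) →
    T (all (λ q → cyclicOK (C ++ A ^ q)) (upTo 4)) → ∀ q → T (cyclicOK (C ++ A ^ q))
  cyclicOK-pump C A w≤|C| w≤|AA| seeds q with all⁺ (λ q → cyclicOK (C ++ A ^ q)) (upTo 4) seeds
  ... | ok₀ All.∷ ok₁ All.∷ ok₂ All.∷ ok₃ All.∷ All.[] = pumped q
    where
    split : ∀ q → T (cyclicOK (C ++ A ^ q)) →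
      T (windowsOK C (A ^ q ++ C ++ A ^ q)) × T (windowsOK (A ^ q) C)
    split q t = T-∧⁻ (subst T (cyclicOK-++ C (A ^ q) w≤|C|) t)

    C-before-AA : T (windowsOK C (A ++ A))
    C-before-AA = subst T (windowsOK-before-^ C A 0 _ w≤|AA|) (proj₁ (split 2 ok₂))

    A-before-AA : T (windowsOK A (A ++ A))
    A-before-AA = subst T (windowsOK-before-^ A A 0 C w≤|AA|)
      (proj₁ (T-∧⁻ (subst T (windowsOK-++ A (A ^ 2) C) (proj₂ (split 3 ok₃)))))

    A^-before-C : ∀ q → T (windowsOK (A ^ (2 + q)) C)
    A^-before-C zero    = proj₂ (split 2 ok₂)
    A^-before-C (suc q) = subst T (sym (windowsOK-++ A (A ^ (2 + q)) C))
      (T-∧⁺ (subst T (sym (windowsOK-before-^ A A q C w≤|AA|)) A-before-AA) (A^-before-C q))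

    pumped : ∀ q → T (cyclicOK (C ++ A ^ q))
    pumped zero          = ok₀
    pumped (suc zero)    = ok₁
    pumped (suc (suc q)) = subst T (sym (cyclicOK-++ C (A ^ (2 + q)) w≤|C|))
      (T-∧⁺ (subst T (sym (windowsOK-before-^ C A q _ w≤|AA|)) C-before-AA) (A^-before-C q))

bounded-labeling⇒span : ∀ {V : Set} {Adj : V → V → Set} {f : V → ℕ} {m} →
  IsL321Labeling Adj f → (∀ x → f x ≤ m) → L321SpanAtMost Adj m
bounded-labeling⇒span {f = f} f-L321 f≤m = f , f-L321 , 0 , λ x → z≤n , f≤m x

!-≤ : ∀ {m xs} → All (_≤ m) xs → ∀ i → xs ! i ≤ m
!-≤ All.[]           _       = z≤n
!-≤ (x≤m All.∷ _)    zero    = x≤m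
!-≤ (_ All.∷ xs≤m)   (suc i) = !-≤ xs≤m i

^⁺ : ∀ {P : ℕ → Set} {xs} → All P xs → ∀ q → All P (xs ^ q)
^⁺ xs-P zero    = All.[]
^⁺ xs-P (suc q) = ++⁺ xs-P (^⁺ xs-P q)

separationOK : ℕ → ℕ → ℕ → Bool
separationOK e a b = need e ≤ᵇ ∣ a - b ∣

open Windows 15 separationOK

module WordLabeling (n : ℕ) .{{_ : NonZero n}} (W : List ℕ) (|W|≡n : length W ≡ n)
                    (15≤n : 15 ≤ n) (W-ok : T (cyclicOK W)) where

  open ModularArithmetic n
  open CirculantWalks n

  label : Fin n → ℕ
  label x = W ! toℕ x

  separated : ∀ {a b e} → a < n → b < n → b ≈ a + suc e → e < 15 →
    need (suc e) ≤ ∣ W ! a - W ! b ∣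
  separated {a} {b} {e} a<n b<n b≈a+e e<15 =
    ≤ᵇ⇒≤ _ _ (subst (λ c → T (separationOK (suc e) (W ! a) (W ! c)))
                    (trans (sym b≈a+e) (m<n⇒m%n≡m b<n))
                    (cyclicOK-sound W |W|≡n W-ok 15≤n a<n e<15))

  offset-bound : ∀ {a b e k} → a < n → b < n → b ≈ a + e → ¬ a ≡ b → T (compatible e k) →
    3 < ∣ W ! a - W ! b ∣ + k
  offset-bound {a} {e = zero} a<n b<n b≈a a≢b _ =
    ⊥-elim (a≢b (sym (≈⇒≡ b<n a<n (trans b≈a (cong (_% n) (+-identityʳ a))))))
  offset-bound {e = suc e} {k} a<n b<n b≈a+e a≢b t with T-∧⁻ t
  ... | e<15 , 4≤need+k =
    ≤-trans (≤ᵇ⇒≤ 4 _ 4≤need+k)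
            (+-monoˡ-≤ k (separated a<n b<n b≈a+e (≤ᵇ⇒≤ (suc e) 15 e<15)))

  short-walk-bound : ∀ {x y} → ¬ x ≡ y → ∀ l → length l ≤ 3 →
    toℕ x + forward l ≈ toℕ y + backward l → 3 < ∣ label x - label y ∣ + length l
  short-walk-bound {x} {y} x≢y l |l|≤3 x→y with displacement-offset {toℕ x} {toℕ y} x→y
  ... | inj₂ y≈x+e = offset-bound (toℕ<n x) (toℕ<n y) y≈x+e (x≢y ∘ toℕ-injective)
                                  (short-sequences-admissible l |l|≤3)
  ... | inj₁ x≈y+e = subst (λ d → 3 < d + length l) (∣-∣-comm (label y) (label x))
                       (offset-bound (toℕ<n y) (toℕ<n x) x≈y+e (x≢y ∘ sym ∘ toℕ-injective)
                                     (short-sequences-admissible l |l|≤3))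

  labeling : IsL321Labeling (CircAdj n (S-1-5 n)) label
  labeling x y x≢y d (walk , _) with 4 ≤? d
  ... | yes 4≤d = ≤-trans 4≤d (m≤n+m d _)
  ... | no  d≱4 with walk⇒steps walk
  ...   | l , refl , x→y = short-walk-bound x≢y l (≤-pred (≰⇒> d≱4)) x→y

block : List ℕ
block = 0 ∷ 3 ∷ 8 ∷ 1 ∷ 4 ∷ 9 ∷ 14 ∷ 5 ∷ 10 ∷ 13 ∷ 6 ∷ 11 ∷ []

prefix : Fin 6 → List ℕ
prefix 0F =
  2 ∷ 7 ∷ 0 ∷ 3 ∷ 8 ∷ 13 ∷ 4 ∷ 9 ∷ 14 ∷ 1 ∷ 6 ∷ 11 ∷ 2 ∷ 7 ∷ 12 ∷ 3 ∷ 8 ∷ 13 ∷ 4 ∷ 9 ∷ 14 ∷ 5 ∷ 10 ∷ 0 ∷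
  6 ∷ 11 ∷ 1 ∷ 7 ∷ 12 ∷ 2 ∷ 8 ∷ 13 ∷ 3 ∷ 9 ∷ 14 ∷ 4 ∷ 10 ∷ 0 ∷ 5 ∷ 11 ∷ 1 ∷ 6 ∷ 12 ∷ 2 ∷ 7 ∷ 13 ∷ 3 ∷ 8 ∷
  14 ∷ 0 ∷ 5 ∷ 11 ∷ 1 ∷ 6 ∷ 12 ∷ 2 ∷ 7 ∷ 13 ∷ 9 ∷ 4 ∷ 14 ∷ 0 ∷ 5 ∷ 2 ∷ 7 ∷ 10 ∷ 3 ∷ 8 ∷ 11 ∷ 0 ∷ 5 ∷ 12 ∷
  1 ∷ 4 ∷ 9 ∷ 2 ∷ 7 ∷ 10 ∷ 13 ∷ 6 ∷ 11 ∷ 0 ∷ 3 ∷ 8 ∷ 1 ∷ 4 ∷ 9 ∷ 14 ∷ 5 ∷ 10 ∷ 13 ∷ 6 ∷ 11 ∷ 0 ∷ 3 ∷ 8 ∷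
  1 ∷ 4 ∷ 9 ∷ 14 ∷ 5 ∷ 10 ∷ 13 ∷ 6 ∷ 11 ∷
  []
prefix 1F =
  0 ∷ 3 ∷ 8 ∷ 1 ∷ 4 ∷ 9 ∷ 6 ∷ 11 ∷ 14 ∷ 7 ∷ 12 ∷ 1 ∷ 4 ∷ 9 ∷ 2 ∷ 5 ∷ 10 ∷ 13 ∷ 6 ∷ 11 ∷ 14 ∷ 3 ∷ 8 ∷ 0 ∷
  4 ∷ 9 ∷ 12 ∷ 5 ∷ 10 ∷ 13 ∷ 6 ∷ 0 ∷ 14 ∷ 7 ∷ 1 ∷ 11 ∷ 8 ∷ 2 ∷ 12 ∷ 9 ∷ 14 ∷ 4 ∷ 10 ∷ 0 ∷ 5 ∷ 2 ∷ 12 ∷ 6 ∷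
  3 ∷ 13 ∷ 7 ∷ 0 ∷ 14 ∷ 8 ∷ 1 ∷ 4 ∷ 9 ∷ 2 ∷ 5 ∷ 10 ∷ 14 ∷ 6 ∷ 11 ∷ 0 ∷ 3 ∷ 8 ∷ 1 ∷ 4 ∷ 9 ∷ 12 ∷ 5 ∷ 10 ∷
  13 ∷ 2 ∷ 7 ∷ 0 ∷ 3 ∷ 8 ∷ 5 ∷ 10 ∷ 13 ∷ 6 ∷ 11 ∷ 0 ∷ 3 ∷ 8 ∷ 1 ∷ 4 ∷ 9 ∷ 14 ∷ 5 ∷ 10 ∷ 13 ∷ 6 ∷ 11 ∷ 0 ∷
  3 ∷ 8 ∷ 1 ∷ 4 ∷ 9 ∷ 14 ∷ 5 ∷ 10 ∷ 13 ∷ 6 ∷ 11 ∷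
  []
prefix 2F =
  2 ∷ 7 ∷ 0 ∷ 3 ∷ 8 ∷ 13 ∷ 4 ∷ 9 ∷ 14 ∷ 1 ∷ 6 ∷ 11 ∷ 2 ∷ 7 ∷ 12 ∷ 3 ∷ 8 ∷ 13 ∷ 4 ∷ 9 ∷ 14 ∷ 5 ∷ 10 ∷ 0 ∷
  6 ∷ 11 ∷ 1 ∷ 7 ∷ 12 ∷ 2 ∷ 8 ∷ 13 ∷ 3 ∷ 9 ∷ 14 ∷ 4 ∷ 10 ∷ 0 ∷ 5 ∷ 11 ∷ 1 ∷ 6 ∷ 12 ∷ 2 ∷ 7 ∷ 13 ∷ 3 ∷ 8 ∷
  14 ∷ 4 ∷ 9 ∷ 0 ∷ 5 ∷ 10 ∷ 1 ∷ 6 ∷ 11 ∷ 2 ∷ 7 ∷ 12 ∷ 3 ∷ 8 ∷ 13 ∷ 4 ∷ 9 ∷ 0 ∷ 5 ∷ 10 ∷ 1 ∷ 6 ∷ 11 ∷ 14 ∷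
  7 ∷ 12 ∷ 3 ∷ 8 ∷ 1 ∷ 4 ∷ 9 ∷ 14 ∷ 5 ∷ 10 ∷ 13 ∷ 6 ∷ 11 ∷ 0 ∷ 3 ∷ 8 ∷ 1 ∷ 4 ∷ 9 ∷ 14 ∷ 5 ∷ 10 ∷ 13 ∷ 6 ∷
  11 ∷ 0 ∷ 3 ∷ 8 ∷ 1 ∷ 4 ∷ 9 ∷ 14 ∷ 5 ∷ 10 ∷ 13 ∷ 6 ∷ 11 ∷
  []
prefix 3F =
  0 ∷ 3 ∷ 8 ∷ 1 ∷ 4 ∷ 9 ∷ 6 ∷ 11 ∷ 14 ∷ 7 ∷ 12 ∷ 1 ∷ 4 ∷ 9 ∷ 2 ∷ 5 ∷ 10 ∷ 13 ∷ 6 ∷ 11 ∷ 14 ∷ 3 ∷ 8 ∷ 0 ∷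
  4 ∷ 9 ∷ 12 ∷ 5 ∷ 10 ∷ 13 ∷ 6 ∷ 0 ∷ 14 ∷ 7 ∷ 1 ∷ 11 ∷ 8 ∷ 2 ∷ 12 ∷ 9 ∷ 14 ∷ 4 ∷ 10 ∷ 0 ∷ 5 ∷ 2 ∷ 12 ∷ 6 ∷
  3 ∷ 13 ∷ 7 ∷ 0 ∷ 14 ∷ 8 ∷ 1 ∷ 10 ∷ 5 ∷ 2 ∷ 11 ∷ 6 ∷ 3 ∷ 13 ∷ 7 ∷ 0 ∷ 14 ∷ 8 ∷ 1 ∷ 10 ∷ 5 ∷ 2 ∷ 11 ∷ 6 ∷
  3 ∷ 12 ∷ 7 ∷ 0 ∷ 14 ∷ 8 ∷ 1 ∷ 4 ∷ 9 ∷ 2 ∷ 5 ∷ 10 ∷ 13 ∷ 6 ∷ 11 ∷ 0 ∷ 3 ∷ 8 ∷ 1 ∷ 4 ∷ 9 ∷ 14 ∷ 5 ∷ 10 ∷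
  13 ∷ 6 ∷ 11 ∷ 0 ∷ 3 ∷ 8 ∷ 1 ∷ 4 ∷ 9 ∷ 14 ∷ 5 ∷ 10 ∷ 13 ∷ 6 ∷ 11 ∷
  []
prefix 4F =
  0 ∷ 3 ∷ 8 ∷ 1 ∷ 4 ∷ 9 ∷ 12 ∷ 5 ∷ 10 ∷ 13 ∷ 2 ∷ 7 ∷ 0 ∷ 3 ∷ 8 ∷ 5 ∷ 10 ∷ 14 ∷ 6 ∷ 11 ∷ 0 ∷ 3 ∷ 8 ∷ 1 ∷
  4 ∷ 9 ∷ 13 ∷ 5 ∷ 10 ∷ 14 ∷ 2 ∷ 7 ∷ 0 ∷ 3 ∷ 8 ∷ 5 ∷ 11 ∷ 14 ∷ 6 ∷ 12 ∷ 0 ∷ 3 ∷ 9 ∷ 1 ∷ 4 ∷ 10 ∷ 13 ∷ 5 ∷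
  11 ∷ 14 ∷ 2 ∷ 8 ∷ 0 ∷ 3 ∷ 9 ∷ 6 ∷ 11 ∷ 14 ∷ 7 ∷ 12 ∷ 0 ∷ 4 ∷ 9 ∷ 1 ∷ 5 ∷ 10 ∷ 13 ∷ 6 ∷ 11 ∷ 14 ∷ 3 ∷ 8 ∷
  0 ∷ 4 ∷ 9 ∷ 6 ∷ 11 ∷ 14 ∷ 7 ∷ 12 ∷ 1 ∷ 4 ∷ 9 ∷ 2 ∷ 5 ∷ 10 ∷ 13 ∷ 6 ∷ 11 ∷ 0 ∷ 3 ∷ 8 ∷ 1 ∷ 4 ∷ 9 ∷ 14 ∷
  5 ∷ 10 ∷ 13 ∷ 6 ∷ 11 ∷ 0 ∷ 3 ∷ 8 ∷ 1 ∷ 4 ∷ 9 ∷ 14 ∷ 5 ∷ 10 ∷ 13 ∷ 6 ∷ 11 ∷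
  []
prefix 5F =
  0 ∷ 3 ∷ 8 ∷ 1 ∷ 4 ∷ 7 ∷ 12 ∷ 5 ∷ 10 ∷ 13 ∷ 2 ∷ 9 ∷ 14 ∷ 3 ∷ 6 ∷ 11 ∷ 4 ∷ 7 ∷ 12 ∷ 9 ∷ 14 ∷ 0 ∷ 10 ∷ 5 ∷
  1 ∷ 7 ∷ 12 ∷ 2 ∷ 8 ∷ 13 ∷ 3 ∷ 9 ∷ 14 ∷ 0 ∷ 6 ∷ 11 ∷ 1 ∷ 7 ∷ 12 ∷ 2 ∷ 8 ∷ 13 ∷ 3 ∷ 9 ∷ 14 ∷ 4 ∷ 10 ∷ 0 ∷
  5 ∷ 11 ∷ 1 ∷ 6 ∷ 12 ∷ 2 ∷ 7 ∷ 13 ∷ 3 ∷ 8 ∷ 14 ∷ 0 ∷ 5 ∷ 11 ∷ 1 ∷ 6 ∷ 12 ∷ 2 ∷ 7 ∷ 13 ∷ 9 ∷ 4 ∷ 14 ∷ 0 ∷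
  5 ∷ 2 ∷ 7 ∷ 10 ∷ 3 ∷ 8 ∷ 11 ∷ 0 ∷ 5 ∷ 12 ∷ 1 ∷ 4 ∷ 9 ∷ 2 ∷ 7 ∷ 10 ∷ 13 ∷ 6 ∷ 11 ∷ 0 ∷ 3 ∷ 8 ∷ 1 ∷ 4 ∷
  9 ∷ 14 ∷ 5 ∷ 10 ∷ 13 ∷ 6 ∷ 11 ∷ 0 ∷ 3 ∷ 8 ∷ 1 ∷ 4 ∷ 9 ∷ 14 ∷ 5 ∷ 10 ∷ 13 ∷ 6 ∷ 11 ∷
  []

length-prefix : ∀ r → length (prefix r) ≡ 105 + 2 * toℕ r
length-prefix 0F = refl
length-prefix 1F = refl
length-prefix 2F = refl
length-prefix 3F = refl
length-prefix 4F = refl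
length-prefix 5F = refl

prefix-certificate : ∀ r →
  T (all (_≤ᵇ 14) (prefix r)) × T (all (λ q → cyclicOK (prefix r ++ block ^ q)) (upTo 4))
prefix-certificate 0F = tt , tt
prefix-certificate 1F = tt , tt
prefix-certificate 2F = tt , tt
prefix-certificate 3F = tt , tt
prefix-certificate 4F = tt , tt
prefix-certificate 5F = tt , tt

word : Fin 6 → ℕ → List ℕ
word r q = prefix r ++ block ^ q

length-word : ∀ r q → length (word r q) ≡ 105 + 2 * toℕ r + 12 * q
length-word r q =
  trans (length-++ (prefix r)) (cong₂ _+_ (length-prefix r) (trans (length-^ block q) (*-comm q 12)))

word-bounded : ∀ r q → All (_≤ 14) (word r q)
word-bounded r q = ++⁺ (≤ᵇ-All (proj₁ (prefix-certificate r))) (^⁺ (≤ᵇ-All {xs = block} tt) q)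
  where
  ≤ᵇ-All : ∀ {xs} → T (all (_≤ᵇ 14) xs) → All (_≤ 14) xs
  ≤ᵇ-All {xs} t = All.map (≤ᵇ⇒≤ _ 14) (all⁺ (_≤ᵇ 14) xs t)

word-cyclicOK : ∀ r q → T (cyclicOK (word r q))
word-cyclicOK r = cyclicOK-pump (prefix r) block 15≤|prefix| (m≤m+n 15 9) (proj₂ (prefix-certificate r))
  where
  15≤|prefix| : 15 ≤ length (prefix r)
  15≤|prefix| = subst (15 ≤_) (sym (length-prefix r)) (≤-trans (m≤m+n 15 90) (m≤m+n 105 _))

odd-decomposition : ∀ {n} → n % 2 ≡ 1 → 105 ≤ n →
  ∃₂ λ (r : Fin 6) q → n ≡ 105 + 2 * toℕ r + 12 * q
odd-decomposition {n} n-odd 105≤n =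
  remainder , quotient , halves {r = toℕ remainder} {quotient} n≡1+h*2 (sym (m+[n∸m]≡n 52≤h)) property
  where
  open DivMod ((n / 2 ∸ 52) divMod 6)
  n≡1+h*2 : n ≡ 1 + n / 2 * 2
  n≡1+h*2 = trans (m≡m%n+[m/n]*n n 2) (cong (_+ n / 2 * 2) n-odd)
  52≤h : 52 ≤ n / 2
  52≤h = *-cancelʳ-≤ 52 (n / 2) 2 (≤-pred (subst (105 ≤_) n≡1+h*2 105≤n))
  rearrange : ∀ r q → 1 + (52 + (r + q * 6)) * 2 ≡ 105 + 2 * r + 12 * q
  rearrange = solve-∀
  halves : ∀ {m h j r q} → m ≡ 1 + h * 2 → h ≡ 52 + j → j ≡ r + q * 6 → m ≡ 105 + 2 * r + 12 * q
  halves {r = r} {q} refl refl refl = rearrange r q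

word-span : ∀ r q → let n = 105 + 2 * toℕ r + 12 * q in L321SpanAtMost (CircAdj n (S-1-5 n)) 14
word-span r q =
  bounded-labeling⇒span (WordLabeling.labeling _ (word r q) (length-word r q) 15≤n (word-cyclicOK r q))
                        (λ x → !-≤ (word-bounded r q) (toℕ x))
  where
  15≤n : 15 ≤ 105 + 2 * toℕ r + 12 * q
  15≤n = ≤-trans (m≤m+n 15 90) (≤-trans (m≤m+n 105 (2 * toℕ r)) (m≤m+n _ (12 * q)))

mainTheorem13 : (n : ℕ) → n % 2 ≡ 1 → 105 ≤ n →
    L321SpanAtMost (CircAdj n (S-1-5 n)) 14
mainTheorem13 n n-odd 105≤n =
  let r , q , n≡n[r,q] = odd-decomposition n-odd 105≤n
  in subst (λ m → L321SpanAtMost (CircAdj m (S-1-5 m)) 14) (sym n≡n[r,q]) (word-span r q)
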